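{- Let $\mathcal{C}\subseteq 2^V$ be a nontrivial Sperner hypergraph and let $h=\Phi_{\mathcal{C}}$. The following are equivalent: (i) $\mathcal{C}$ satisfies the circuit axiom (C3): if $C_1,C_2\in\mathcal{C}$ are distinct and $u\in C_1\cap C_2$, then some $C_3\in\mathcal{C}$ satisfies $C_3\subseteq(C_1\cup C_2)\setminus\{u\}$; (ii) for any $X\subseteq V$ and any $v\in V\setminus X$, $r_{\mathcal{C}}(X\cup\{v\})=r_{\mathcal{C}}(X)$ if and only if there exists $C\in\mathcal{C}$ with $C\setminus X=\{v\}$; (iii) for any $X\subseteq V$, $r_{\mathcal{C}}(\mathbb{T}_h(X))=r_{\mathcal{C}}(X)$; (iv) for any $X\subseteq V$, $\mathbb{T}_h(X)=\{v\in V: r_{\mathcal{C}}(X\cup\{v\})=r_{\mathcal{C}}(X)\}$; (v) for any $X\subseteq V$, $\mathbb{T}_h(X)=\mathbb{T}^1_{\Phi_{\mathcal{C}}}(X)$; (vi) for any $X\subseteq V$, $\mathbb{I}_{\mathcal{C}}(X)=\{v\in X: r_{\mathcal{C}}(X\setminus\{v\})=r_{\mathcal{C}}(X)\}$.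
   Context: The definite Horn clause $B\to v$ ($v\notin B$) is the Boolean function on subsets of $V$ whose true sets are the $T$ with $B\not\subseteq T$ or $B\cup\{v\}\subseteq T$; $\Phi_{\mathcal{C}}=\bigwedge_{C\in\mathcal{C}}\bigwedge_{v\in C}((C\setminus\{v\})\to v)$. $\mathbb{T}_h(X)$ is the smallest true set of $h$ containing $X$. The single forward-chaining step is $\mathbb{T}^1_{\Phi_{\mathcal{C}}}(X)=X\cup\{v\in V\setminus X: \exists C\in\mathcal{C},\ v\in C,\ C\setminus\{v\}\subseteq X\}$. $\mathcal{C}^{dc}$ is the family of inclusion-maximal sets containing no member of $\mathcal{C}$ (complements of minimal transversals), and the rank is $r_{\mathcal{C}}(X)=\max_{B\in\mathcal{C}^{dc}}|B\cap X|$. A clause $B\to v$ is an implicate of $h$ if $h\le(B\to v)$; a set $I$ is an implicate set of $h$ if $(I\setminus\{v\})\to v$ is an implicate of $h$ for all $v\in I$; implicate sets are closed under union, and $\mathbb{I}_{\mathcal{C}}(X)$ (the core of $X$) denotes the unique maximal implicate set of $h=\Phi_{\mathcal{C}}$ contained in $X$. Sperner: no hyperedge properly contains another; nontrivial means here $\mathcal{C}\neq\emptyset$ and $\emptyset\notin\mathcal{C}$. -}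

module Defs where

-- Ground set V = Fin n; subsets of V are Data.Fin.Subset (Vec Bool n).
-- A hypergraph is a finite list of hyperedges (subsets of V).

open import Data.Nat using (ℕ; _≤_)
open import Data.Fin using (Fin)
open import Data.Fin.Subset
  using (Subset; _∈_; _∉_; _⊆_; _⊂_; _∪_; _∩_; _─_; _-_; ⁅_⁆; ∣_∣)
  renaming (⊥ to ∅)
open import Data.List using (List; [])
open import Data.List.Membership.Propositional using () renaming (_∈_ to _∈ₗ_)
open import Data.Product using (_×_; Σ; ∃; ∃-syntax; _,_)
open import Data.Sum using (_⊎_)
open import Relation.Nullary using (¬_)
open import Relation.Binary.PropositionalEquality using (_≡_; _≢_)
open import Function.Bundles using (_⇔_)

Hypergraph : ℕ → Set
Hypergraph n = List (Subset n)

-- Boolean functions on subsets of V, given by their true sets.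
BoolFun : ℕ → Set₁
BoolFun n = Subset n → Set

module _ {n : ℕ} where

  Clause : Subset n → Fin n → BoolFun n
  Clause B v T = (¬ (B ⊆ T)) ⊎ ((B ∪ ⁅ v ⁆) ⊆ T)

  Φ : Hypergraph n → BoolFun n
  Φ 𝒞 T = ∀ C → C ∈ₗ 𝒞 → ∀ v → v ∈ C → Clause (C - v) v T

  _≤ᵇ_ : BoolFun n → BoolFun n → Set
  h ≤ᵇ g = ∀ T → h T → g T

  IsClosure : BoolFun n → Subset n → Subset n → Set
  IsClosure h X Y = h Y × X ⊆ Y × (∀ Z → h Z → X ⊆ Z → Y ⊆ Z)

  InT1 : Hypergraph n → Subset n → Fin n → Set
  InT1 𝒞 X v = v ∈ X ⊎ (v ∉ X × (∃[ C ] (C ∈ₗ 𝒞 × v ∈ C × (C - v) ⊆ X)))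

  Independent : Hypergraph n → Subset n → Set
  Independent 𝒞 B = ∀ C → C ∈ₗ 𝒞 → ¬ (C ⊆ B)

  InDC : Hypergraph n → Subset n → Set
  InDC 𝒞 B = Independent 𝒞 B × (∀ B′ → B ⊂ B′ → ¬ Independent 𝒞 B′)

  HasRank : Hypergraph n → Subset n → ℕ → Set
  HasRank 𝒞 X k =
    (∃[ B ] (InDC 𝒞 B × ∣ B ∩ X ∣ ≡ k)) × (∀ B → InDC 𝒞 B → ∣ B ∩ X ∣ ≤ k)

  SameRank : Hypergraph n → Subset n → Subset n → Set
  SameRank 𝒞 X Y = ∀ j k → HasRank 𝒞 X j → HasRank 𝒞 Y k → j ≡ k

  Implicate : BoolFun n → Subset n → Fin n → Set
  Implicate h B v = h ≤ᵇ Clause B v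

  ImplicateSet : BoolFun n → Subset n → Set
  ImplicateSet h I = ∀ v → v ∈ I → Implicate h (I - v) v

  IsCore : BoolFun n → Subset n → Subset n → Set
  IsCore h X I =
    I ⊆ X × ImplicateSet h I × (∀ J → J ⊆ X → ImplicateSet h J → J ⊆ I)

  Sperner : Hypergraph n → Set
  Sperner 𝒞 = ∀ C D → C ∈ₗ 𝒞 → D ∈ₗ 𝒞 → ¬ (C ⊂ D)

  Nontrivial : Hypergraph n → Set
  Nontrivial 𝒞 = (𝒞 ≢ []) × ¬ (∅ ∈ₗ 𝒞)

  CircuitAxiom : Hypergraph n → Set
  CircuitAxiom 𝒞 =
    ∀ C₁ C₂ → C₁ ∈ₗ 𝒞 → C₂ ∈ₗ 𝒞 → C₁ ≢ C₂ → ∀ u → u ∈ C₁ → u ∈ C₂ →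
    ∃[ C₃ ] (C₃ ∈ₗ 𝒞 × C₃ ⊆ ((C₁ ∪ C₂) - u))

  Cond2 : Hypergraph n → Set
  Cond2 𝒞 = ∀ X v → v ∉ X →
    (SameRank 𝒞 (X ∪ ⁅ v ⁆) X ⇔ (∃[ C ] (C ∈ₗ 𝒞 × (C ─ X) ≡ ⁅ v ⁆)))

  Cond3 : Hypergraph n → Set
  Cond3 𝒞 = ∀ X Y → IsClosure (Φ 𝒞) X Y → SameRank 𝒞 Y X

  Cond4 : Hypergraph n → Set
  Cond4 𝒞 = ∀ X → ∃[ Y ] (IsClosure (Φ 𝒞) X Y ×
    (∀ v → (v ∈ Y ⇔ SameRank 𝒞 (X ∪ ⁅ v ⁆) X)))

  Cond5 : Hypergraph n → Set
  Cond5 𝒞 = ∀ X → ∃[ Y ] (IsClosure (Φ 𝒞) X Y × (∀ v → (v ∈ Y ⇔ InT1 𝒞 X v)))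

  Cond6 : Hypergraph n → Set
  Cond6 𝒞 = ∀ X → ∃[ I ] (IsCore (Φ 𝒞) X I ×
    (∀ v → (v ∈ I ⇔ (v ∈ X × SameRank 𝒞 (X - v) X))))

-- Call a set independent if it contains no hyperedge, and say that a hyperedge C fires v from X
-- when v ∈ C and C ∖ {v} ⊆ X. Then 𝕋¹(X) is X together with everything fired from X, the true
-- sets of Φ_𝒞 are the sets closed under firing, and r_𝒞(X) is the largest size of an independent
-- subset of X.
--
-- Under (C3), strong circuit elimination shows that whatever is fired from 𝕋¹(X) is already fired
-- from X, so 𝕋(X) = 𝕋¹(X); a basis-exchange argument shows that adding a fired element does not
-- raise the rank, while an element that is not fired extends a maximum independent subset. The
-- core of X is then the union of the hyperedges inside X. Conversely, if (C3) fails for C₁, C₂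
-- and u, Sperner gives a ∈ C₁ ∖ C₂ and S = (C₁ ∪ C₂) ∖ {u} is independent. X₀ = S ∖ {a} fires u
-- by C₂ and then a by C₁, so each of (ii)–(iv) would give X₀ the rank |S|, and (v) would put a
-- hyperedge inside S. For (vi), a lies in the core of C₁ ∪ C₂ since C₁ does, and keeping the
-- rank after removing a forces the hyperedge C₂ ⊆ (C₁ ∪ C₂) ∖ {a} to be independent.

module Submission where

open import Defs
open import Data.Nat using (ℕ; zero; suc; _≤_; _<_; s≤s)
import Data.Nat as ℕ
open import Data.Nat.Properties
  using (≤-refl; ≤-reflexive; ≤-trans; ≤-pred; ≤∧≢⇒<; n≤0⇒n≡0; n≤1+n; <⇒≱; ≤-antisym)
open import Data.Nat.Induction using (<-wellFounded)
open import Induction.WellFounded using (Acc; acc)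
open import Data.Fin using (Fin; zero; suc; _≟_)
open import Data.Fin.Properties using (any?)
open import Data.Fin.Subset
  using (Subset; _∈_; _∉_; _⊆_; _⊂_; _∪_; _∩_; _─_; _-_; ⁅_⁆; ∣_∣; ∁; ⊤; inside; outside)
  renaming (⊥ to ∅)
open import Data.Fin.Subset.Properties
  using (_∈?_; _⊆?_; anySubset?; ⊆-refl; ⊆-trans; ⊆-antisym; ⊥⊆; ∣p∣≤n; ⊆⊤;
         x∈⁅x⁆; x∈⁅y⁆⇒x≡y; ∪-identityʳ; p⊆q⇒∣p∣≤∣q∣; p⊂q⇒∣p∣<∣q∣; p⊂q⇒∁p⊃∁q;
         p∩q⊆p; p∩q⊆q; x∈p∩q⁺; p⊆p∪q; q⊆p∪q; x∈p∪q⁻; x∈p∪q⁺;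
         p─q⊆p; p─x─y≡p─y─x; ⊆-reflexive; x∈p∧x∉q⇒x∈p─q; x∈p∧x≢y⇒x∈p-y; x∈p⇒∣p-x∣<∣p∣)
open import Data.Vec using (tabulate; _∷_; here; there)
open import Data.Vec.Properties using (lookup∘tabulate; []=⇒lookup; lookup⇒[]=)
open import Data.List using (List)
open import Data.List.Membership.Propositional using (find; lose) renaming (_∈_ to _∈ₗ_)
open import Data.List.Relation.Unary.Any using () renaming (any? to anyₗ?)
open import Data.Product using (_×_; ∃; ∃-syntax; _,_; proj₁; proj₂)
open import Data.Sum using (_⊎_; inj₁; inj₂)
open import Data.Empty using (⊥-elim)
open import Relation.Nullary using (¬_; Dec; yes; no; does)
open import Relation.Nullary.Decidable
  using (_×-dec_; _⊎-dec_; ¬?; map′; dec-true; decidable-stable)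
open import Relation.Unary using (Decidable)
open import Relation.Binary.PropositionalEquality using (_≡_; _≢_; refl; sym; trans; subst; subst₂)
open import Function using (_∘_)
open import Function.Bundles using (_⇔_; mk⇔; Equivalence)


x∈p─q⇒x∉q : ∀ {m} {x : Fin m} (p q : Subset m) → x ∈ p ─ q → x ∉ q
x∈p─q⇒x∉q (_ ∷ p) (outside ∷ q) here ()
x∈p─q⇒x∉q (_ ∷ p) (outside ∷ q) (there x∈p─q) (there x∈q) = x∈p─q⇒x∉q p q x∈p─q x∈q
x∈p─q⇒x∉q (_ ∷ p) (inside ∷ q) (there x∈p─q) (there x∈q) = x∈p─q⇒x∉q p q x∈p─q x∈q

∣p∪⁅x⁆∣≤1+∣p∣ : ∀ {m} (p : Subset m) (x : Fin m) → ∣ p ∪ ⁅ x ⁆ ∣ ≤ suc ∣ p ∣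
∣p∪⁅x⁆∣≤1+∣p∣ (inside ∷ p) zero rewrite ∪-identityʳ p = n≤1+n _
∣p∪⁅x⁆∣≤1+∣p∣ (outside ∷ p) zero rewrite ∪-identityʳ p = ≤-refl
∣p∪⁅x⁆∣≤1+∣p∣ (inside ∷ p) (suc x) = s≤s (∣p∪⁅x⁆∣≤1+∣p∣ p x)
∣p∪⁅x⁆∣≤1+∣p∣ (outside ∷ p) (suc x) = ∣p∪⁅x⁆∣≤1+∣p∣ p x

module _ {m : ℕ} where

  private variable
    p q r : Subset m
    x y : Fin m

  x∈p-y⇒x≢y : x ∈ p - y → x ≢ y
  x∈p-y⇒x≢y {y = y} x∈p-y refl = x∈p─q⇒x∉q _ ⁅ y ⁆ x∈p-y (x∈⁅x⁆ y)

  x∈p-y⇒x∈p : x ∈ p - y → x ∈ p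
  x∈p-y⇒x∈p = p─q⊆p _ _

  x∉p-x : x ∉ p - x
  x∉p-x x∈p-x = x∈p-y⇒x≢y x∈p-x refl

  x∈p∪⁅y⁆⁻ : x ∈ p ∪ ⁅ y ⁆ → x ∈ p ⊎ x ≡ y
  x∈p∪⁅y⁆⁻ {p = p} {y = y} x∈ with x∈p∪q⁻ p ⁅ y ⁆ x∈
  ... | inj₁ x∈p = inj₁ x∈p
  ... | inj₂ x∈⁅y⁆ = inj₂ (x∈⁅y⁆⇒x≡y y x∈⁅y⁆)

  y∈p∪⁅y⁆ : y ∈ p ∪ ⁅ y ⁆
  y∈p∪⁅y⁆ {y = y} = x∈p∪q⁺ (inj₂ (x∈⁅x⁆ y))

  ∪⁅⁆-least : p ⊆ q → y ∈ q → p ∪ ⁅ y ⁆ ⊆ q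
  ∪⁅⁆-least p⊆q y∈q x∈ with x∈p∪⁅y⁆⁻ x∈
  ... | inj₁ x∈p = p⊆q x∈p
  ... | inj₂ refl = y∈q

  p-y⊆q⇒p⊆q∪⁅y⁆ : p - y ⊆ q → p ⊆ q ∪ ⁅ y ⁆
  p-y⊆q⇒p⊆q∪⁅y⁆ {y = y} p-y⊆q {x} x∈p with x ≟ y
  ... | yes refl = y∈p∪⁅y⁆
  ... | no x≢y = p⊆p∪q _ (p-y⊆q (x∈p∧x≢y⇒x∈p-y x∈p x≢y))

  p⊆q∪⁅y⁆⇒p-y⊆q : p ⊆ q ∪ ⁅ y ⁆ → p - y ⊆ q
  p⊆q∪⁅y⁆⇒p-y⊆q p⊆q∪⁅y⁆ x∈p-y with x∈p∪⁅y⁆⁻ (p⊆q∪⁅y⁆ (x∈p-y⇒x∈p x∈p-y))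
  ... | inj₁ x∈q = x∈q
  ... | inj₂ refl = ⊥-elim (x∉p-x x∈p-y)

  p⊆p-y∪⁅y⁆ : p ⊆ (p - y) ∪ ⁅ y ⁆
  p⊆p-y∪⁅y⁆ = p-y⊆q⇒p⊆q∪⁅y⁆ ⊆-refl

  ∣p∣≤1+∣p-y∣ : ∀ p (y : Fin m) → ∣ p ∣ ≤ suc ∣ p - y ∣
  ∣p∣≤1+∣p-y∣ p y = ≤-trans (p⊆q⇒∣p∣≤∣q∣ (p⊆p-y∪⁅y⁆ {p = p} {y = y})) (∣p∪⁅x⁆∣≤1+∣p∣ (p - y) y)

  p⊆q⇒p-y⊆q-y : p ⊆ q → p - y ⊆ q - y
  p⊆q⇒p-y⊆q-y p⊆q x∈p-y = x∈p∧x≢y⇒x∈p-y (p⊆q (x∈p-y⇒x∈p x∈p-y)) (x∈p-y⇒x≢y x∈p-y)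

  p⊆q∧y∉p⇒p⊆q-y : p ⊆ q → y ∉ p → p ⊆ q - y
  p⊆q∧y∉p⇒p⊆q-y p⊆q y∉p x∈p = x∈p∧x≢y⇒x∈p-y (p⊆q x∈p) λ { refl → y∉p x∈p }

  ∪-least : p ⊆ r → q ⊆ r → p ∪ q ⊆ r
  ∪-least {p} {q = q} p⊆r q⊆r x∈p∪q with x∈p∪q⁻ p q x∈p∪q
  ... | inj₁ x∈p = p⊆r x∈p
  ... | inj₂ x∈q = q⊆r x∈q

  x∉p∪q : x ∉ p → x ∉ q → x ∉ p ∪ q
  x∉p∪q {p = p} {q = q} x∉p x∉q x∈p∪q with x∈p∪q⁻ p q x∈p∪q
  ... | inj₁ x∈p = x∉p x∈p
  ... | inj₂ x∈q = x∉q x∈q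

  p⊆q∪r⇒p─r⊆q─r : p ⊆ q ∪ r → p ─ r ⊆ q ─ r
  p⊆q∪r⇒p─r⊆q─r {p} {q} {r} p⊆q∪r x∈p─r with x∈p∪q⁻ q r (p⊆q∪r (p─q⊆p p r x∈p─r))
  ... | inj₁ x∈q = x∈p∧x∉q⇒x∈p─q x∈q (x∈p─q⇒x∉q p r x∈p─r)
  ... | inj₂ x∈r = ⊥-elim (x∈p─q⇒x∉q p r x∈p─r x∈r)

  p⊂p∪⁅y⁆ : y ∉ p → p ⊂ p ∪ ⁅ y ⁆
  p⊂p∪⁅y⁆ y∉p = p⊆p∪q _ , _ , y∈p∪⁅y⁆ , y∉p

  ¬⊆⇒∃∉ : ¬ p ⊆ q → ∃[ x ] (x ∈ p × x ∉ q)
  ¬⊆⇒∃∉ {p} {q} p⊈q with any? (λ x → x ∈? p ×-dec ¬? (x ∈? q))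
  ... | yes witness = witness
  ... | no ∄ = ⊥-elim (p⊈q λ {x} x∈p → decidable-stable (x ∈? q) λ x∉q → ∄ (x , x∈p , x∉q))

  p⊆q∧∣q∣≤∣p∣⇒q⊆p : p ⊆ q → ∣ q ∣ ≤ ∣ p ∣ → q ⊆ p
  p⊆q∧∣q∣≤∣p∣⇒q⊆p {p} p⊆q ∣q∣≤∣p∣ {x} x∈q =
    decidable-stable (x ∈? p) λ x∉p → <⇒≱ (p⊂q⇒∣p∣<∣q∣ (p⊆q , x , x∈q , x∉p)) ∣q∣≤∣p∣

  ─≡⁅⁆⇔ : y ∉ q → (p ─ q ≡ ⁅ y ⁆) ⇔ (y ∈ p × p - y ⊆ q)
  ─≡⁅⁆⇔ {y} {q} {p} y∉q = mk⇔ to from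
    where
    to : p ─ q ≡ ⁅ y ⁆ → y ∈ p × p - y ⊆ q
    to eq = p─q⊆p p q y∈p─q , λ {x} x∈p-y → decidable-stable (x ∈? q) λ x∉q →
      x∈p-y⇒x≢y x∈p-y (x∈⁅y⁆⇒x≡y y (subst (x ∈_) eq (x∈p∧x∉q⇒x∈p─q (x∈p-y⇒x∈p x∈p-y) x∉q)))
      where
      y∈p─q : y ∈ p ─ q
      y∈p─q = subst (y ∈_) (sym eq) (x∈⁅x⁆ y)
    from : y ∈ p × p - y ⊆ q → p ─ q ≡ ⁅ y ⁆
    from (y∈p , p-y⊆q) = ⊆-antisym ⊆⁅y⁆ ⁅y⁆⊆
      where
      ⊆⁅y⁆ : p ─ q ⊆ ⁅ y ⁆
      ⊆⁅y⁆ {x} x∈p─q with x ≟ y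
      ... | yes refl = x∈⁅x⁆ y
      ... | no x≢y = ⊥-elim (x∈p─q⇒x∉q p q x∈p─q (p-y⊆q (x∈p∧x≢y⇒x∈p-y (p─q⊆p p q x∈p─q) x≢y)))
      ⁅y⁆⊆ : ⁅ y ⁆ ⊆ p ─ q
      ⁅y⁆⊆ x∈⁅y⁆ rewrite x∈⁅y⁆⇒x≡y y x∈⁅y⁆ = x∈p∧x∉q⇒x∈p─q y∈p y∉q

module _ {m : ℕ} {P : Fin m → Set} (P? : Decidable P) where

  fromPred : Subset m
  fromPred = tabulate (λ x → does (P? x))

  ∈-fromPred⁺ : ∀ {x} → P x → x ∈ fromPred
  ∈-fromPred⁺ {x} px = lookup⇒[]= x fromPred (trans (lookup∘tabulate _ x) (dec-true (P? x) px))

  ∈-fromPred⁻ : ∀ {x} → x ∈ fromPred → P x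
  ∈-fromPred⁻ {x} x∈ with P? x | trans (sym (lookup∘tabulate (λ x → does (P? x)) x)) ([]=⇒lookup x∈)
  ... | yes px | _ = px
  ... | no _ | ()

any∈? : {A : Set} {P : A → Set} → Decidable P → (xs : List A) → Dec (∃[ x ] (x ∈ₗ xs × P x))
any∈? P? xs = map′ find (λ (_ , x∈xs , px) → lose x∈xs px) (anyₗ? P? xs)

module _ {m : ℕ} {P : Subset m → Set} (P? : Decidable P) where

  maximum : ∀ {I} → P I → ∃[ M ] (P M × ∀ {J} → P J → ∣ J ∣ ≤ ∣ M ∣)
  maximum {I} pI = search m (λ {J} _ → ∣p∣≤n J)
    where
    search : ∀ k → (∀ {J} → P J → ∣ J ∣ ≤ k) → ∃[ M ] (P M × ∀ {J} → P J → ∣ J ∣ ≤ ∣ M ∣)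
    search k bound with anySubset? (λ J → P? J ×-dec (∣ J ∣ ℕ.≟ k))
    search k bound | yes (M , pM , ∣M∣≡k) = M , pM , λ pJ → subst (_ ≤_) (sym ∣M∣≡k) (bound pJ)
    search zero bound | no ∄ = ⊥-elim (∄ (I , pI , n≤0⇒n≡0 (bound pI)))
    search (suc k) bound | no ∄ = search k λ pJ → ≤-pred (≤∧≢⇒< (bound pJ) λ eq → ∄ (_ , pJ , eq))

inflationary-fixpoint : ∀ {m} (f : Subset m → Subset m) → (∀ {Y} → Y ⊆ f Y) →
                        {Q : Subset m → Set} → (∀ {Y} → Q Y → Q (f Y)) →
                        ∀ {Y} → Q Y → ∃[ Z ] (Y ⊆ Z × Q Z × f Z ⊆ Z)
inflationary-fixpoint f inflate {Q} preserve qY = go qY (<-wellFounded _)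
  where
  go : ∀ {Y} → Q Y → Acc _<_ ∣ ∁ Y ∣ → ∃[ Z ] (Y ⊆ Z × Q Z × f Z ⊆ Z)
  go {Y} qY (acc smaller) with f Y ⊆? Y
  ... | yes fY⊆Y = Y , ⊆-refl , qY , fY⊆Y
  ... | no fY⊈Y =
    let Z , fY⊆Z , qZ , fZ⊆Z = go (preserve qY) (smaller (p⊂q⇒∣p∣<∣q∣ (p⊂q⇒∁p⊃∁q Y⊂fY)))
    in Z , ⊆-trans inflate fY⊆Z , qZ , fZ⊆Z
    where
    Y⊂fY : Y ⊂ f Y
    Y⊂fY = let x , x∈fY , x∉Y = ¬⊆⇒∃∉ fY⊈Y in inflate , x , x∈fY , x∉Y

module _ {n : ℕ} {B T : Subset n} {v : Fin n} where

  clause-elim : Clause B v T → B ⊆ T → v ∈ T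
  clause-elim (inj₁ B⊈T) B⊆T = ⊥-elim (B⊈T B⊆T)
  clause-elim (inj₂ B∪v⊆T) _ = B∪v⊆T y∈p∪⁅y⁆

  clause-intro : (B ⊆ T → v ∈ T) → Clause B v T
  clause-intro fire with B ⊆? T
  ... | yes B⊆T = inj₂ (∪⁅⁆-least B⊆T (fire B⊆T))
  ... | no B⊈T = inj₁ B⊈T

module Circuits {n : ℕ} (𝒞 : Hypergraph n) where

  private variable
    B C D I J M X Y Z : Subset n
    v x : Fin n
    j k : ℕ

  Fires : Subset n → Fin n → Set
  Fires X v = ∃[ C ] (C ∈ₗ 𝒞 × v ∈ C × C - v ⊆ X)

  fires? : ∀ X → Decidable (Fires X)
  fires? X v = any∈? (λ C → v ∈? C ×-dec C - v ⊆? X) 𝒞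

  fires-mono : X ⊆ Y → Fires X v → Fires Y v
  fires-mono X⊆Y (C , C∈𝒞 , v∈C , C-v⊆X) = C , C∈𝒞 , v∈C , ⊆-trans C-v⊆X X⊆Y

  T¹ : Subset n → Subset n
  T¹ X = fromPred (λ v → v ∈? X ⊎-dec fires? X v)

  ∈-T¹⁻ : v ∈ T¹ X → v ∈ X ⊎ Fires X v
  ∈-T¹⁻ {X = X} = ∈-fromPred⁻ (λ v → v ∈? X ⊎-dec fires? X v)

  ∈-T¹⁺ : v ∈ X ⊎ Fires X v → v ∈ T¹ X
  ∈-T¹⁺ {X = X} = ∈-fromPred⁺ (λ v → v ∈? X ⊎-dec fires? X v)

  X⊆T¹ : X ⊆ T¹ X
  X⊆T¹ v∈X = ∈-T¹⁺ (inj₁ v∈X)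

  fires⇒∈T¹ : Fires X v → v ∈ T¹ X
  fires⇒∈T¹ fires = ∈-T¹⁺ (inj₂ fires)

  ∈-T¹⇔InT1 : v ∈ T¹ X ⇔ InT1 𝒞 X v
  ∈-T¹⇔InT1 {v} {X} = mk⇔ to (λ { (inj₁ v∈X) → X⊆T¹ v∈X ; (inj₂ (_ , fires)) → fires⇒∈T¹ fires })
    where
    to : v ∈ T¹ X → InT1 𝒞 X v
    to v∈T¹ with v ∈? X | ∈-T¹⁻ v∈T¹
    ... | yes v∈X | _ = inj₁ v∈X
    ... | no v∉X | inj₁ v∈X = ⊥-elim (v∉X v∈X)
    ... | no v∉X | inj₂ fires = inj₂ (v∉X , fires)

  fires⇔─≡⁅⁆ : v ∉ X → Fires X v ⇔ (∃[ C ] (C ∈ₗ 𝒞 × C ─ X ≡ ⁅ v ⁆))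
  fires⇔─≡⁅⁆ v∉X = mk⇔
    (λ (C , C∈𝒞 , v∈C , C-v⊆X) → C , C∈𝒞 , Equivalence.from (─≡⁅⁆⇔ v∉X) (v∈C , C-v⊆X))
    (λ (C , C∈𝒞 , C─X≡v) → C , C∈𝒞 , Equivalence.to (─≡⁅⁆⇔ v∉X) C─X≡v)

  circuit-implicateSet : C ∈ₗ 𝒞 → ImplicateSet (Φ 𝒞) C
  circuit-implicateSet C∈𝒞 v v∈C T ΦT = ΦT _ C∈𝒞 v v∈C

  Φ⇒fires-closed : Φ 𝒞 Y → Fires Y v → v ∈ Y
  Φ⇒fires-closed ΦY (C , C∈𝒞 , v∈C , C-v⊆Y) = clause-elim (ΦY C C∈𝒞 _ v∈C) C-v⊆Y

  fires-closed⇒Φ : (∀ {v} → Fires Y v → v ∈ Y) → Φ 𝒞 Y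
  fires-closed⇒Φ closed C C∈𝒞 v v∈C = clause-intro λ C-v⊆Y → closed (C , C∈𝒞 , v∈C , C-v⊆Y)

  T¹-least : Φ 𝒞 Z → X ⊆ Z → T¹ X ⊆ Z
  T¹-least ΦZ X⊆Z v∈T¹ with ∈-T¹⁻ v∈T¹
  ... | inj₁ v∈X = X⊆Z v∈X
  ... | inj₂ fires = Φ⇒fires-closed ΦZ (fires-mono X⊆Z fires)

  T¹-isClosure : Φ 𝒞 (T¹ X) → IsClosure (Φ 𝒞) X (T¹ X)
  T¹-isClosure ΦT¹ = ΦT¹ , X⊆T¹ , λ _ → T¹-least

  closure-exists : ∀ X → ∃[ Y ] IsClosure (Φ 𝒞) X Y
  closure-exists X =
    let Y , X⊆Y , least , T¹Y⊆Y =
          inflationary-fixpoint T¹ X⊆T¹ {Q = Below} preserve (λ _ _ X⊆Z → X⊆Z)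
    in Y , fires-closed⇒Φ (λ fires → T¹Y⊆Y (fires⇒∈T¹ fires)) , X⊆Y , least
    where
    Below : Subset n → Set
    Below Y = ∀ Z → Φ 𝒞 Z → X ⊆ Z → Y ⊆ Z
    preserve : ∀ {Y} → Below Y → Below (T¹ Y)
    preserve least Z ΦZ X⊆Z = T¹-least ΦZ (least Z ΦZ X⊆Z)

  ⋃circuits : Subset n → Subset n
  ⋃circuits X = fromPred (λ v → any∈? (λ C → v ∈? C ×-dec C ⊆? X) 𝒞)

  ∈⋃circuits⁻ : v ∈ ⋃circuits X → ∃[ C ] (C ∈ₗ 𝒞 × v ∈ C × C ⊆ X)
  ∈⋃circuits⁻ {X = X} = ∈-fromPred⁻ (λ v → any∈? (λ C → v ∈? C ×-dec C ⊆? X) 𝒞)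

  ∈⋃circuits⁺ : C ∈ₗ 𝒞 → C ⊆ X → C ⊆ ⋃circuits X
  ∈⋃circuits⁺ {X = X} C∈𝒞 C⊆X v∈C =
    ∈-fromPred⁺ (λ v → any∈? (λ C → v ∈? C ×-dec C ⊆? X) 𝒞) (_ , C∈𝒞 , v∈C , C⊆X)

  ⋃circuits⊆ : ⋃circuits X ⊆ X
  ⋃circuits⊆ v∈⋃ = let _ , _ , v∈C , C⊆X = ∈⋃circuits⁻ v∈⋃ in C⊆X v∈C

  ∈⋃circuits⇒fires : v ∈ ⋃circuits X → Fires (X - v) v
  ∈⋃circuits⇒fires v∈⋃ =
    let C , C∈𝒞 , v∈C , C⊆X = ∈⋃circuits⁻ v∈⋃ in C , C∈𝒞 , v∈C , p⊆q⇒p-y⊆q-y C⊆X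

  fires⇒∈⋃circuits : v ∈ X → Fires (X - v) v → v ∈ ⋃circuits X
  fires⇒∈⋃circuits v∈X (C , C∈𝒞 , v∈C , C-v⊆X-v) =
    ∈⋃circuits⁺ C∈𝒞 (⊆-trans (p-y⊆q⇒p⊆q∪⁅y⁆ C-v⊆X-v) (∪⁅⁆-least x∈p-y⇒x∈p v∈X)) v∈C

  ⋃circuits-implicateSet : ImplicateSet (Φ 𝒞) (⋃circuits X)
  ⋃circuits-implicateSet v v∈⋃ T ΦT = clause-intro λ ⋃-v⊆T →
    let C , C∈𝒞 , v∈C , C⊆X = ∈⋃circuits⁻ v∈⋃
    in Φ⇒fires-closed ΦT (C , C∈𝒞 , v∈C , ⊆-trans (p⊆q⇒p-y⊆q-y (∈⋃circuits⁺ C∈𝒞 C⊆X)) ⋃-v⊆T)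

  independent-⊆ : I ⊆ J → Independent 𝒞 J → Independent 𝒞 I
  independent-⊆ I⊆J indJ C C∈𝒞 C⊆I = indJ C C∈𝒞 (⊆-trans C⊆I I⊆J)

  independent? : Decidable (Independent 𝒞)
  independent? X with any∈? (λ C → C ⊆? X) 𝒞
  ... | yes (C , C∈𝒞 , C⊆X) = no λ indX → indX C C∈𝒞 C⊆X
  ... | no ∄ = yes λ C C∈𝒞 C⊆X → ∄ (C , C∈𝒞 , C⊆X)

  independent-∪⁅⁆ : Independent 𝒞 J → ¬ Fires J x → Independent 𝒞 (J ∪ ⁅ x ⁆)
  independent-∪⁅⁆ {x = x} indJ ¬fires C C∈𝒞 C⊆J∪x with x ∈? C
  ... | yes x∈C = ¬fires (C , C∈𝒞 , x∈C , p⊆q∪⁅y⁆⇒p-y⊆q C⊆J∪x)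
  ... | no x∉C = indJ C C∈𝒞 λ y∈C →
    p⊆q∪⁅y⁆⇒p-y⊆q C⊆J∪x (x∈p∧x≢y⇒x∈p-y y∈C λ { refl → x∉C y∈C })

  MaxIndependent : Subset n → Subset n → Subset n → Set
  MaxIndependent I X M =
    I ⊆ M × M ⊆ X × Independent 𝒞 M ×
    (∀ {J} → I ⊆ J → J ⊆ X → Independent 𝒞 J → ∣ J ∣ ≤ ∣ M ∣)

  maxIndependent-exists : Independent 𝒞 I → I ⊆ X → ∃ (MaxIndependent I X)
  maxIndependent-exists {I} {X} indI I⊆X =
    let M , (I⊆M , M⊆X , indM) , largest = maximum between? (⊆-refl , I⊆X , indI)
    in M , I⊆M , M⊆X , indM , λ I⊆J J⊆X indJ → largest (I⊆J , J⊆X , indJ)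
    where
    between? : Decidable (λ J → I ⊆ J × J ⊆ X × Independent 𝒞 J)
    between? J = I ⊆? J ×-dec J ⊆? X ×-dec independent? J

  MaxIndependent⇒spans : MaxIndependent I X M → X ⊆ T¹ M
  MaxIndependent⇒spans {M = M} (I⊆M , M⊆X , indM , largest) {x} x∈X with x ∈? M
  ... | yes x∈M = X⊆T¹ x∈M
  ... | no x∉M = fires⇒∈T¹ (decidable-stable (fires? M x) λ ¬fires →
    <⇒≱ (p⊂q⇒∣p∣<∣q∣ (p⊂p∪⁅y⁆ x∉M))
        (largest (⊆-trans I⊆M (p⊆p∪q _)) (∪⁅⁆-least M⊆X x∈X) (independent-∪⁅⁆ indM ¬fires)))

  MaxIndependent⇒InDC : MaxIndependent I ⊤ M → InDC 𝒞 M
  MaxIndependent⇒InDC (I⊆M , _ , indM , largest) =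
    indM , λ B M⊂B indB → <⇒≱ (p⊂q⇒∣p∣<∣q∣ M⊂B) (largest (⊆-trans I⊆M (proj₁ M⊂B)) ⊆⊤ indB)

  extendToDC : Independent 𝒞 I → ∃[ B ] (I ⊆ B × InDC 𝒞 B)
  extendToDC indI =
    let B , max = maxIndependent-exists indI ⊆⊤ in B , proj₁ max , MaxIndependent⇒InDC max

  MaxIndependent⇒HasRank : MaxIndependent ∅ X M → HasRank 𝒞 X ∣ M ∣
  MaxIndependent⇒HasRank {X} {M} (_ , M⊆X , indM , largest) =
    let B , M⊆B , dcB = extendToDC indM
    in (B , dcB , ≤-antisym (bound dcB) (p⊆q⇒∣p∣≤∣q∣ λ x∈M → x∈p∩q⁺ (M⊆B x∈M , M⊆X x∈M))) ,
       λ _ → bound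
    where
    bound : InDC 𝒞 B → ∣ B ∩ X ∣ ≤ ∣ M ∣
    bound {B} (indB , _) = largest ⊥⊆ (p∩q⊆q B X) (independent-⊆ (p∩q⊆p B X) indB)

  HasRank⇒MaxIndependent : HasRank 𝒞 X k → ∃[ M ] (MaxIndependent ∅ X M × ∣ M ∣ ≡ k)
  HasRank⇒MaxIndependent {X} ((B , (indB , _) , ∣B∩X∣≡k) , bound) =
    B ∩ X , (⊥⊆ , p∩q⊆q B X , independent-⊆ (p∩q⊆p B X) indB , largest) , ∣B∩X∣≡k
    where
    largest : ∀ {J} → ∅ ⊆ J → J ⊆ X → Independent 𝒞 J → ∣ J ∣ ≤ ∣ B ∩ X ∣
    largest _ J⊆X indJ =
      let B′ , J⊆B′ , dcB′ = extendToDC indJ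
      in ≤-trans (p⊆q⇒∣p∣≤∣q∣ λ x∈J → x∈p∩q⁺ (J⊆B′ x∈J , J⊆X x∈J))
                 (subst (_ ≤_) (sym ∣B∩X∣≡k) (bound B′ dcB′))

  -- r_𝒞(X) ≤ r_𝒞(Y) (see ≤ᵣ⇒rank≤), stated without computing either rank.
  infix 4 _≤ᵣ_
  _≤ᵣ_ : Subset n → Subset n → Set
  X ≤ᵣ Y = ∀ {I} → Independent 𝒞 I → I ⊆ X → ∃[ J ] (Independent 𝒞 J × J ⊆ Y × ∣ I ∣ ≤ ∣ J ∣)

  ⊆⇒≤ᵣ : X ⊆ Y → X ≤ᵣ Y
  ⊆⇒≤ᵣ X⊆Y {I} indI I⊆X = I , indI , ⊆-trans I⊆X X⊆Y , ≤-refl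

  ≤ᵣ-trans : X ≤ᵣ Y → Y ≤ᵣ Z → X ≤ᵣ Z
  ≤ᵣ-trans X≤Y Y≤Z indI I⊆X =
    let J , indJ , J⊆Y , ∣I∣≤∣J∣ = X≤Y indI I⊆X
        K , indK , K⊆Z , ∣J∣≤∣K∣ = Y≤Z indJ J⊆Y
    in K , indK , K⊆Z , ≤-trans ∣I∣≤∣J∣ ∣J∣≤∣K∣

  ≤ᵣ⇒rank≤ : X ≤ᵣ Y → HasRank 𝒞 X j → HasRank 𝒞 Y k → j ≤ k
  ≤ᵣ⇒rank≤ X≤Y rankX rankY =
    let M , (_ , M⊆X , indM , _) , ∣M∣≡j = HasRank⇒MaxIndependent rankX
        N , (_ , _ , _ , largest) , ∣N∣≡k = HasRank⇒MaxIndependent rankY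
        J , indJ , J⊆Y , ∣M∣≤∣J∣ = X≤Y indM M⊆X
    in subst₂ _≤_ ∣M∣≡j ∣N∣≡k (≤-trans ∣M∣≤∣J∣ (largest ⊥⊆ J⊆Y indJ))

  ≤ᵣ-antisym : X ≤ᵣ Y → Y ≤ᵣ X → SameRank 𝒞 X Y
  ≤ᵣ-antisym X≤Y Y≤X _ _ rankX rankY =
    ≤-antisym (≤ᵣ⇒rank≤ X≤Y rankX rankY) (≤ᵣ⇒rank≤ Y≤X rankY rankX)

  SameRank-sym : SameRank 𝒞 X Y → SameRank 𝒞 Y X
  SameRank-sym same j k rankY rankX = sym (same k j rankX rankY)

  record C3Violation : Set where
    field
      C₁ C₂ : Subset n
      C₁∈𝒞 : C₁ ∈ₗ 𝒞
      C₂∈𝒞 : C₂ ∈ₗ 𝒞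
      u a : Fin n
      u∈C₁ : u ∈ C₁
      u∈C₂ : u ∈ C₂
      a∈C₁ : a ∈ C₁
      a∉C₂ : a ∉ C₂
      independent : Independent 𝒞 ((C₁ ∪ C₂) - u)

  module Rank (∅∉𝒞 : ¬ ∅ ∈ₗ 𝒞) where

    basis-exists : ∀ X → ∃ (MaxIndependent ∅ X)
    basis-exists X = maxIndependent-exists independent-∅ ⊥⊆
      where
      independent-∅ : Independent 𝒞 ∅
      independent-∅ C C∈𝒞 C⊆∅ = ∅∉𝒞 (subst (_∈ₗ 𝒞) (⊆-antisym C⊆∅ ⊥⊆) C∈𝒞)

    SameRank⇒≤ᵣ : SameRank 𝒞 X Y → X ≤ᵣ Y
    SameRank⇒≤ᵣ {X} {Y} same indI I⊆X =
      let M , maxM@(_ , _ , _ , largestM) = basis-exists X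
          N , maxN@(_ , N⊆Y , indN , _) = basis-exists Y
          ∣M∣≡∣N∣ = same _ _ (MaxIndependent⇒HasRank maxM) (MaxIndependent⇒HasRank maxN)
      in N , indN , N⊆Y , ≤-trans (largestM ⊥⊆ I⊆X indI) (≤-reflexive ∣M∣≡∣N∣)

    ∪⁅⁆≤ᵣ⇒fires : v ∉ X → X ∪ ⁅ v ⁆ ≤ᵣ X → Fires X v
    ∪⁅⁆≤ᵣ⇒fires {v} {X} v∉X X∪v≤X = decidable-stable (fires? X v) λ ¬fires →
      let M , (_ , M⊆X , indM , largest) = basis-exists X
          J , indJ , J⊆X , ∣M∪v∣≤∣J∣ =
            X∪v≤X (independent-∪⁅⁆ indM (¬fires ∘ fires-mono M⊆X))
                  (∪⁅⁆-least (⊆-trans M⊆X (p⊆p∪q _)) y∈p∪⁅y⁆)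
      in <⇒≱ (p⊂q⇒∣p∣<∣q∣ (p⊂p∪⁅y⁆ (v∉X ∘ M⊆X))) (≤-trans ∣M∪v∣≤∣J∣ (largest ⊥⊆ J⊆X indJ))

    module _ (violation : C3Violation) where
      open C3Violation violation

      private
        U S X₀ : Subset n
        U = C₁ ∪ C₂
        S = U - u
        X₀ = S - a

        a∈S : a ∈ S
        a∈S = x∈p∧x≢y⇒x∈p-y (p⊆p∪q _ a∈C₁) λ { refl → a∉C₂ u∈C₂ }

        S⊆X₀∪a : S ⊆ X₀ ∪ ⁅ a ⁆
        S⊆X₀∪a = p⊆p-y∪⁅y⁆

        fires-u : Fires X₀ u
        fires-u = C₂ , C₂∈𝒞 , u∈C₂ ,
                  p⊆q∧y∉p⇒p⊆q-y (p⊆q⇒p-y⊆q-y (q⊆p∪q C₁ C₂)) (a∉C₂ ∘ x∈p-y⇒x∈p)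

        fires-a : Fires (X₀ ∪ ⁅ u ⁆) a
        fires-a = C₁ , C₁∈𝒞 , a∈C₁ , p-y⊆q⇒p⊆q∪⁅y⁆
          (⊆-trans (⊆-reflexive (p─x─y≡p─y─x C₁ a u)) (p⊆q⇒p-y⊆q-y (p⊆q⇒p-y⊆q-y (p⊆p∪q C₂))))

        a∈closed : Φ 𝒞 Y → X₀ ⊆ Y → a ∈ Y
        a∈closed ΦY X₀⊆Y = Φ⇒fires-closed ΦY
          (fires-mono (∪⁅⁆-least X₀⊆Y (Φ⇒fires-closed ΦY (fires-mono X₀⊆Y fires-u))) fires-a)

        S≰ᵣX₀ : ¬ S ≤ᵣ X₀
        S≰ᵣX₀ S≤X₀ = let J , _ , J⊆X₀ , ∣S∣≤∣J∣ = S≤X₀ independent ⊆-refl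
                     in <⇒≱ (x∈p⇒∣p-x∣<∣p∣ a∈S) (≤-trans ∣S∣≤∣J∣ (p⊆q⇒∣p∣≤∣q∣ J⊆X₀))

      violation⇒¬Cond2 : ¬ Cond2 𝒞
      violation⇒¬Cond2 cond2 =
        S≰ᵣX₀ (≤ᵣ-trans (⊆⇒≤ᵣ S⊆X₀∪u∪a)
                        (≤ᵣ-trans (cond2⇒≤ᵣ a∉X₀∪u fires-a) (cond2⇒≤ᵣ (x∉p-x ∘ x∈p-y⇒x∈p) fires-u)))
        where
        cond2⇒≤ᵣ : ∀ {Y v} → v ∉ Y → Fires Y v → Y ∪ ⁅ v ⁆ ≤ᵣ Y
        cond2⇒≤ᵣ v∉Y fires =
          SameRank⇒≤ᵣ (Equivalence.from (cond2 _ _ v∉Y) (Equivalence.to (fires⇔─≡⁅⁆ v∉Y) fires))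
        a∉X₀∪u : a ∉ X₀ ∪ ⁅ u ⁆
        a∉X₀∪u a∈ with x∈p∪⁅y⁆⁻ a∈
        ... | inj₁ a∈X₀ = x∉p-x a∈X₀
        ... | inj₂ refl = a∉C₂ u∈C₂
        S⊆X₀∪u∪a : S ⊆ (X₀ ∪ ⁅ u ⁆) ∪ ⁅ a ⁆
        S⊆X₀∪u∪a = ⊆-trans S⊆X₀∪a (∪⁅⁆-least (⊆-trans (p⊆p∪q _) (p⊆p∪q _)) y∈p∪⁅y⁆)

      violation⇒¬Cond3 : ¬ Cond3 𝒞
      violation⇒¬Cond3 cond3 =
        let Y , closure@(ΦY , X₀⊆Y , _) = closure-exists X₀
            S⊆Y = ⊆-trans S⊆X₀∪a (∪⁅⁆-least X₀⊆Y (a∈closed ΦY X₀⊆Y))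
        in S≰ᵣX₀ (≤ᵣ-trans (⊆⇒≤ᵣ S⊆Y) (SameRank⇒≤ᵣ (cond3 X₀ Y closure)))

      violation⇒¬Cond4 : ¬ Cond4 𝒞
      violation⇒¬Cond4 cond4 =
        let Y , (ΦY , X₀⊆Y , _) , Y≡stable = cond4 X₀
            X₀∪a≤X₀ = SameRank⇒≤ᵣ (Equivalence.to (Y≡stable a) (a∈closed ΦY X₀⊆Y))
        in S≰ᵣX₀ (≤ᵣ-trans (⊆⇒≤ᵣ S⊆X₀∪a) X₀∪a≤X₀)

      violation⇒¬Cond5 : ¬ Cond5 𝒞
      violation⇒¬Cond5 cond5 with cond5 X₀
      ... | Y , (ΦY , X₀⊆Y , _) , Y≡T¹ with Equivalence.to (Y≡T¹ a) (a∈closed ΦY X₀⊆Y)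
      ...   | inj₁ a∈X₀ = x∉p-x a∈X₀
      ...   | inj₂ (_ , C , C∈𝒞 , a∈C , C-a⊆X₀) =
        independent C C∈𝒞 (⊆-trans (p-y⊆q⇒p⊆q∪⁅y⁆ C-a⊆X₀) (∪⁅⁆-least x∈p-y⇒x∈p a∈S))

      violation⇒¬Cond6 : ¬ Cond6 𝒞
      violation⇒¬Cond6 cond6 =
        let I , (_ , _ , maximal) , I≡stable = cond6 U
            a∈I = maximal C₁ (p⊆p∪q C₂) (circuit-implicateSet C₁∈𝒞) a∈C₁
            U≤U-a = SameRank⇒≤ᵣ (SameRank-sym (proj₂ (Equivalence.to (I≡stable a) a∈I)))
            J , indJ , J⊆U-a , ∣S∣≤∣J∣ = U≤U-a independent x∈p-y⇒x∈p
            ∣U-a∣≤∣J∣ = ≤-pred (≤-trans (x∈p⇒∣p-x∣<∣p∣ (p⊆p∪q C₂ a∈C₁))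
                                        (≤-trans (∣p∣≤1+∣p-y∣ U u) (s≤s ∣S∣≤∣J∣)))
            C₂⊆U-a = p⊆q∧y∉p⇒p⊆q-y (q⊆p∪q C₁ C₂) a∉C₂
        in indJ C₂ C₂∈𝒞 (⊆-trans C₂⊆U-a (p⊆q∧∣q∣≤∣p∣⇒q⊆p J⊆U-a ∣U-a∣≤∣J∣))

  module Clutter (∅∉𝒞 : ¬ ∅ ∈ₗ 𝒞) (sperner : Sperner 𝒞) where

    open Rank ∅∉𝒞

    distinct⇒∃∉ : C ∈ₗ 𝒞 → D ∈ₗ 𝒞 → C ≢ D → ∃[ x ] (x ∈ C × x ∉ D)
    distinct⇒∃∉ {C} {D} C∈𝒞 D∈𝒞 C≢D = ¬⊆⇒∃∉ λ C⊆D →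
      sperner C D C∈𝒞 D∈𝒞 (C⊆D , ¬⊆⇒∃∉ λ D⊆C → C≢D (⊆-antisym C⊆D D⊆C))

    noViolation⇒circuitAxiom : ¬ C3Violation → CircuitAxiom 𝒞
    noViolation⇒circuitAxiom ¬violation C₁ C₂ C₁∈𝒞 C₂∈𝒞 C₁≢C₂ u u∈C₁ u∈C₂
      with any∈? (λ C → C ⊆? (C₁ ∪ C₂) - u) 𝒞
    ... | yes C₃ = C₃
    ... | no ∄ =
      let a , a∈C₁ , a∉C₂ = distinct⇒∃∉ C₁∈𝒞 C₂∈𝒞 C₁≢C₂
      in ⊥-elim (¬violation (record
        { C₁ = C₁ ; C₂ = C₂ ; C₁∈𝒞 = C₁∈𝒞 ; C₂∈𝒞 = C₂∈𝒞 ; u = u ; a = a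
        ; u∈C₁ = u∈C₁ ; u∈C₂ = u∈C₂ ; a∈C₁ = a∈C₁ ; a∉C₂ = a∉C₂
        ; independent = λ C C∈𝒞 C⊆ → ∄ (C , C∈𝒞 , C⊆) }))

    module _ (circuitAxiom : CircuitAxiom 𝒞) where

      -- If the hyperedge given by (C3) misses f, eliminate twice inside strictly smaller unions.
      strong-elimination : ∀ {C₁ C₂ e f} → C₁ ∈ₗ 𝒞 → C₂ ∈ₗ 𝒞 → e ∈ C₁ → e ∈ C₂ → f ∈ C₁ → f ∉ C₂ →
                           ∃[ C ] (C ∈ₗ 𝒞 × f ∈ C × C ⊆ (C₁ ∪ C₂) - e)
      strong-elimination C₁∈𝒞 C₂∈𝒞 e∈C₁ e∈C₂ f∈C₁ f∉C₂ =
        go C₁∈𝒞 C₂∈𝒞 e∈C₁ e∈C₂ f∈C₁ f∉C₂ (<-wellFounded _)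
        where
        go : ∀ {C₁ C₂ e f} → C₁ ∈ₗ 𝒞 → C₂ ∈ₗ 𝒞 → e ∈ C₁ → e ∈ C₂ → f ∈ C₁ → f ∉ C₂ →
             Acc _<_ ∣ C₁ ∪ C₂ ∣ → ∃[ C ] (C ∈ₗ 𝒞 × f ∈ C × C ⊆ (C₁ ∪ C₂) - e)
        go {C₁} {C₂} {e} {f} C₁∈𝒞 C₂∈𝒞 e∈C₁ e∈C₂ f∈C₁ f∉C₂ (acc smaller)
          with circuitAxiom C₁ C₂ C₁∈𝒞 C₂∈𝒞 (λ { refl → f∉C₂ f∈C₁ }) e e∈C₁ e∈C₂
        ... | C₃ , C₃∈𝒞 , C₃⊆ with f ∈? C₃
        ...   | yes f∈C₃ = C₃ , C₃∈𝒞 , f∈C₃ , C₃⊆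
        ...   | no f∉C₃ =
          let g , g∈C₃ , g∉C₁ = distinct⇒∃∉ C₃∈𝒞 C₁∈𝒞 λ { refl → e∉C₃ e∈C₁ }
              g∈C₂ = decidable-stable (g ∈? C₂) λ g∉C₂ → x∉p∪q g∉C₁ g∉C₂ (C₃⊆C₁∪C₂ g∈C₃)
              C₄ , C₄∈𝒞 , e∈C₄ , C₄⊆ = go C₂∈𝒞 C₃∈𝒞 g∈C₂ g∈C₃ e∈C₂ e∉C₃
                (smaller (p⊂q⇒∣p∣<∣q∣ (C₂∪C₃⊆C₁∪C₂ , f , p⊆p∪q _ f∈C₁ , f∉C₂∪C₃)))
              C₁∪C₄⊆C₁∪C₂ : C₁ ∪ C₄ ⊆ C₁ ∪ C₂
              C₁∪C₄⊆C₁∪C₂ = ∪-least (p⊆p∪q C₂) λ x∈C₄ → C₂∪C₃⊆C₁∪C₂ (x∈p-y⇒x∈p (C₄⊆ x∈C₄))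
              C₅ , C₅∈𝒞 , f∈C₅ , C₅⊆ =
                go C₁∈𝒞 C₄∈𝒞 e∈C₁ e∈C₄ f∈C₁ (λ f∈C₄ → f∉C₂∪C₃ (x∈p-y⇒x∈p (C₄⊆ f∈C₄)))
                   (smaller (p⊂q⇒∣p∣<∣q∣ (C₁∪C₄⊆C₁∪C₂ , g , q⊆p∪q C₁ C₂ g∈C₂ ,
                                          x∉p∪q g∉C₁ (x∉p-x ∘ C₄⊆))))
          in C₅ , C₅∈𝒞 , f∈C₅ , ⊆-trans C₅⊆ (p⊆q⇒p-y⊆q-y C₁∪C₄⊆C₁∪C₂)
          where
          e∉C₃ : e ∉ C₃
          e∉C₃ = x∉p-x ∘ C₃⊆
          C₃⊆C₁∪C₂ : C₃ ⊆ C₁ ∪ C₂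
          C₃⊆C₁∪C₂ = x∈p-y⇒x∈p ∘ C₃⊆
          C₂∪C₃⊆C₁∪C₂ : C₂ ∪ C₃ ⊆ C₁ ∪ C₂
          C₂∪C₃⊆C₁∪C₂ = ∪-least (q⊆p∪q C₁ C₂) C₃⊆C₁∪C₂
          f∉C₂∪C₃ : f ∉ C₂ ∪ C₃
          f∉C₂∪C₃ = x∉p∪q f∉C₂ f∉C₃

      -- A point w ∈ C ∖ {v} outside X is fired by some D; eliminating w between C and D gives a
      -- hyperedge through v with fewer points outside X.
      fires-T¹⇒fires : v ∉ X → Fires (T¹ X) v → Fires X v
      fires-T¹⇒fires {v} {X} v∉X (C , C∈𝒞 , v∈C , C-v⊆T¹) = go C∈𝒞 v∈C C-v⊆T¹ (<-wellFounded _)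
        where
        go : ∀ {C} → C ∈ₗ 𝒞 → v ∈ C → C - v ⊆ T¹ X → Acc _<_ ∣ C ─ X ∣ → Fires X v
        go {C} C∈𝒞 v∈C C-v⊆T¹ (acc smaller) with C - v ⊆? X
        ... | yes C-v⊆X = C , C∈𝒞 , v∈C , C-v⊆X
        ... | no C-v⊈X with ¬⊆⇒∃∉ C-v⊈X
        ...   | w , w∈C-v , w∉X with ∈-T¹⁻ (C-v⊆T¹ w∈C-v)
        ...     | inj₁ w∈X = ⊥-elim (w∉X w∈X)
        ...     | inj₂ (D , D∈𝒞 , w∈D , D-w⊆X) =
          let C′ , C′∈𝒞 , v∈C′ , C′⊆ = strong-elimination C∈𝒞 D∈𝒞 w∈C w∈D v∈C v∉D
              C′⊆C∪X : C′ ⊆ C ∪ X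
              C′⊆C∪X = C∪D-w⊆C∪X ∘ C′⊆
          in go C′∈𝒞 v∈C′ (⊆-trans (p⊆q⇒p-y⊆q-y C′⊆C∪X) C∪X-v⊆T¹)
                (smaller (p⊂q⇒∣p∣<∣q∣ (p⊆q∪r⇒p─r⊆q─r C′⊆C∪X , w ,
                                       x∈p∧x∉q⇒x∈p─q w∈C w∉X , x∉p-x ∘ C′⊆ ∘ p─q⊆p _ _)))
          where
          w∈C : w ∈ C
          w∈C = x∈p-y⇒x∈p w∈C-v
          v∉D : v ∉ D
          v∉D v∈D = v∉X (D-w⊆X (x∈p∧x≢y⇒x∈p-y v∈D λ { refl → x∉p-x w∈C-v }))
          C∪D-w⊆C∪X : (C ∪ D) - w ⊆ C ∪ X
          C∪D-w⊆C∪X x∈ with x∈p∪q⁻ C D (x∈p-y⇒x∈p x∈)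
          ... | inj₁ x∈C = p⊆p∪q X x∈C
          ... | inj₂ x∈D = q⊆p∪q C X (D-w⊆X (x∈p∧x≢y⇒x∈p-y x∈D (x∈p-y⇒x≢y x∈)))
          C∪X-v⊆T¹ : (C ∪ X) - v ⊆ T¹ X
          C∪X-v⊆T¹ x∈ with x∈p∪q⁻ C X (x∈p-y⇒x∈p x∈)
          ... | inj₁ x∈C = C-v⊆T¹ (x∈p∧x≢y⇒x∈p-y x∈C (x∈p-y⇒x≢y x∈))
          ... | inj₂ x∈X = X⊆T¹ x∈X

      T¹-Φ : Φ 𝒞 (T¹ X)
      T¹-Φ {X} = fires-closed⇒Φ closed
        where
        closed : Fires (T¹ X) v → v ∈ T¹ X
        closed {v} fires with v ∈? X
        ... | yes v∈X = X⊆T¹ v∈X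
        ... | no v∉X = fires⇒∈T¹ (fires-T¹⇒fires v∉X fires)

      -- A maximum independent J ⊇ I ∖ {v} inside X fires v by a hyperedge D ⊈ I, and exchanging
      -- some y ∈ D ∖ I for v shows ∣ I ∣ ≤ ∣ J ∣.
      exchange : Independent 𝒞 I → v ∈ I → v ∉ X → I - v ⊆ X → Fires X v →
                 ∃[ J ] (Independent 𝒞 J × J ⊆ X × ∣ I ∣ ≤ ∣ J ∣)
      exchange {I} {v} indI v∈I v∉X I-v⊆X (C , C∈𝒞 , v∈C , C-v⊆X) =
        let J , max@(I-v⊆J , J⊆X , indJ , _) =
              maxIndependent-exists (independent-⊆ x∈p-y⇒x∈p indI) I-v⊆X
            D , D∈𝒞 , v∈D , D-v⊆J = fires-T¹⇒fires (v∉X ∘ J⊆X)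
                                       (C , C∈𝒞 , v∈C , ⊆-trans C-v⊆X (MaxIndependent⇒spans max))
            y , y∈D , y∉I = ¬⊆⇒∃∉ (indI D D∈𝒞)
            y∈J = D-v⊆J (x∈p∧x≢y⇒x∈p-y y∈D λ y≡v → y∉I (subst (_∈ I) (sym y≡v) v∈I))
            I⊆J-y∪v = p-y⊆q⇒p⊆q∪⁅y⁆ (p⊆q∧y∉p⇒p⊆q-y I-v⊆J (y∉I ∘ x∈p-y⇒x∈p))
        in J , indJ , J⊆X ,
           ≤-trans (p⊆q⇒∣p∣≤∣q∣ I⊆J-y∪v) (≤-trans (∣p∪⁅x⁆∣≤1+∣p∣ (J - y) v) (x∈p⇒∣p-x∣<∣p∣ y∈J))

      fires⇒∪⁅⁆≤ᵣ : Fires X v → X ∪ ⁅ v ⁆ ≤ᵣ X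
      fires⇒∪⁅⁆≤ᵣ {X} {v} fires {I} indI I⊆X∪v with I ⊆? X
      ... | yes I⊆X = I , indI , I⊆X , ≤-refl
      ... | no I⊈X with ¬⊆⇒∃∉ I⊈X
      ...   | z , z∈I , z∉X with x∈p∪⁅y⁆⁻ (I⊆X∪v z∈I)
      ...     | inj₁ z∈X = ⊥-elim (z∉X z∈X)
      ...     | inj₂ refl = exchange indI z∈I z∉X (p⊆q∪⁅y⁆⇒p-y⊆q I⊆X∪v) fires

      T¹-≤ᵣ : X ⊆ Z → Z ⊆ T¹ X → Z ≤ᵣ X
      T¹-≤ᵣ X⊆Z Z⊆T¹ = go X⊆Z Z⊆T¹ (<-wellFounded _)
        where
        go : ∀ {X Z} → X ⊆ Z → Z ⊆ T¹ X → Acc _<_ ∣ Z ∣ → Z ≤ᵣ X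
        go {X} {Z} X⊆Z Z⊆T¹ (acc smaller) with Z ⊆? X
        ... | yes Z⊆X = ⊆⇒≤ᵣ Z⊆X
        ... | no Z⊈X with ¬⊆⇒∃∉ Z⊈X
        ...   | v , v∈Z , v∉X with ∈-T¹⁻ (Z⊆T¹ v∈Z)
        ...     | inj₁ v∈X = ⊥-elim (v∉X v∈X)
        ...     | inj₂ fires =
          ≤ᵣ-trans (⊆⇒≤ᵣ p⊆p-y∪⁅y⁆)
            (≤ᵣ-trans (fires⇒∪⁅⁆≤ᵣ (fires-mono X⊆Z-v fires))
                      (go X⊆Z-v (Z⊆T¹ ∘ x∈p-y⇒x∈p) (smaller (x∈p⇒∣p-x∣<∣p∣ v∈Z))))
          where
          X⊆Z-v : X ⊆ Z - v
          X⊆Z-v = p⊆q∧y∉p⇒p⊆q-y X⊆Z v∉X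

      fires⇒SameRank : Fires X v → SameRank 𝒞 (X ∪ ⁅ v ⁆) X
      fires⇒SameRank fires = ≤ᵣ-antisym (fires⇒∪⁅⁆≤ᵣ fires) (⊆⇒≤ᵣ (p⊆p∪q _))

      circuitAxiom⇒Cond2 : Cond2 𝒞
      circuitAxiom⇒Cond2 X v v∉X = mk⇔
        (λ same → Equivalence.to (fires⇔─≡⁅⁆ v∉X) (∪⁅⁆≤ᵣ⇒fires v∉X (SameRank⇒≤ᵣ same)))
        (λ circuit → fires⇒SameRank (Equivalence.from (fires⇔─≡⁅⁆ v∉X) circuit))

      circuitAxiom⇒Cond3 : Cond3 𝒞
      circuitAxiom⇒Cond3 X Y (_ , X⊆Y , least) =
        ≤ᵣ-antisym (T¹-≤ᵣ X⊆Y (least (T¹ X) T¹-Φ X⊆T¹)) (⊆⇒≤ᵣ X⊆Y)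

      circuitAxiom⇒Cond4 : Cond4 𝒞
      circuitAxiom⇒Cond4 X = T¹ X , T¹-isClosure T¹-Φ , λ v → mk⇔
        (λ v∈T¹ → ≤ᵣ-antisym (T¹-≤ᵣ (p⊆p∪q _) (∪⁅⁆-least X⊆T¹ v∈T¹)) (⊆⇒≤ᵣ (p⊆p∪q _)))
        stable⇒∈T¹
        where
        stable⇒∈T¹ : SameRank 𝒞 (X ∪ ⁅ v ⁆) X → v ∈ T¹ X
        stable⇒∈T¹ {v} same with v ∈? X
        ... | yes v∈X = X⊆T¹ v∈X
        ... | no v∉X = fires⇒∈T¹ (∪⁅⁆≤ᵣ⇒fires v∉X (SameRank⇒≤ᵣ same))

      circuitAxiom⇒Cond5 : Cond5 𝒞
      circuitAxiom⇒Cond5 X = T¹ X , T¹-isClosure T¹-Φ , λ _ → ∈-T¹⇔InT1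

      ⋃circuits-maximal : J ⊆ X → ImplicateSet (Φ 𝒞) J → J ⊆ ⋃circuits X
      ⋃circuits-maximal {J = J} J⊆X impJ {v} v∈J
        with ∈-T¹⁻ (clause-elim (impJ v v∈J (T¹ (J - v)) T¹-Φ) X⊆T¹)
      ... | inj₁ v∈J-v = ⊥-elim (x∉p-x v∈J-v)
      ... | inj₂ fires = fires⇒∈⋃circuits (J⊆X v∈J) (fires-mono (p⊆q⇒p-y⊆q-y J⊆X) fires)

      circuitAxiom⇒Cond6 : Cond6 𝒞
      circuitAxiom⇒Cond6 X =
        ⋃circuits X , (⋃circuits⊆ , ⋃circuits-implicateSet , λ _ → ⋃circuits-maximal) , λ v → mk⇔
          (λ v∈⋃ → ⋃circuits⊆ v∈⋃ ,
                   ≤ᵣ-antisym (⊆⇒≤ᵣ x∈p-y⇒x∈p)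
                              (≤ᵣ-trans (⊆⇒≤ᵣ p⊆p-y∪⁅y⁆) (fires⇒∪⁅⁆≤ᵣ (∈⋃circuits⇒fires v∈⋃))))
          (λ (v∈X , same) → fires⇒∈⋃circuits v∈X (∪⁅⁆≤ᵣ⇒fires x∉p-x
            (≤ᵣ-trans (⊆⇒≤ᵣ (∪⁅⁆-least x∈p-y⇒x∈p v∈X)) (SameRank⇒≤ᵣ (SameRank-sym same)))))

lemma9 : {n : ℕ} (𝒞 : Hypergraph n) → Nontrivial 𝒞 → Sperner 𝒞 →
         (CircuitAxiom 𝒞 ⇔ Cond2 𝒞) × (CircuitAxiom 𝒞 ⇔ Cond3 𝒞) ×
         (CircuitAxiom 𝒞 ⇔ Cond4 𝒞) × (CircuitAxiom 𝒞 ⇔ Cond5 𝒞) ×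
         (CircuitAxiom 𝒞 ⇔ Cond6 𝒞)
lemma9 𝒞 (_ , ∅∉𝒞) sperner =
  characterises circuitAxiom⇒Cond2 violation⇒¬Cond2 ,
  characterises circuitAxiom⇒Cond3 violation⇒¬Cond3 ,
  characterises circuitAxiom⇒Cond4 violation⇒¬Cond4 ,
  characterises circuitAxiom⇒Cond5 violation⇒¬Cond5 ,
  characterises circuitAxiom⇒Cond6 violation⇒¬Cond6
  where
  open Circuits 𝒞
  open Rank ∅∉𝒞
  open Clutter ∅∉𝒞 sperner

  characterises : {P : Set} → (CircuitAxiom 𝒞 → P) → (C3Violation → ¬ P) → CircuitAxiom 𝒞 ⇔ P
  characterises sound refuted =
    mk⇔ sound λ p → noViolation⇒circuitAxiom λ violation → refuted violation p
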